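{- Let $K(t,x,z)=\sum_{S} t^{\mathrm{da}(S)}x^{m(S)}z^{|S|}$, where the sum is over all compositions $S$ (of all nonnegative integers, including the empty composition), $m(S)$ is the number of parts of $S$, $|S|$ is the sum of its parts, and $\mathrm{da}(S)$ is its degree of asymmetry. Then $$K(t,x,z)=\frac{(1-z+xz)(1-z^2)}{(1-z)(1-(1+x^2)z^2)-2tx^2z^3}.$$
   Context: A composition of $n$ with $m$ parts is a sequence $(a_1,\dots,a_m)$ of positive integers ($m\ge 0$) with $a_1+\dots+a_m=n$. For a finite sequence $S=(a_1,\dots,a_m)$, its degree of asymmetry is $\mathrm{da}(S)=|\{i: 1\le i\le m/2,\ a_i\neq a_{m+1-i}\}|$, the number of symmetrically positioned pairs of distinct entries. -}

module Defs where

open import Data.Nat as ℕ using (ℕ; zero; suc; _∸_; _/_)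
open import Data.Integer as ℤ using (ℤ; +_)
open import Data.List using (List; []; _∷_; length; map; concatMap; upTo; filter; reverse; take; zipWith)
open import Data.Bool using (Bool; true; false)
open import Relation.Nullary using (¬_)
open import Relation.Nullary.Decidable using (_×-dec_; ⌊_⌋)
open import Relation.Binary.PropositionalEquality using (_≡_)

-- compsFuel f n : all compositions of n (lists of positive integers summing
-- to n), enumerated by choice of the first part; f is recursion fuel,
-- sufficient whenever f ≥ n (each step decreases n by at least 1).
compsFuel : ℕ → ℕ → List (List ℕ)
compsFuel _       zero    = [] ∷ []
compsFuel zero    (suc n) = []
compsFuel (suc f) (suc n) =
  concatMap (λ a → map (suc a ∷_) (compsFuel f (n ∸ a))) (upTo (suc n))

compositions : ℕ → List (List ℕ)
compositions n = compsFuel n n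

countTrue : List Bool → ℕ
countTrue []           = 0
countTrue (true ∷ bs)  = suc (countTrue bs)
countTrue (false ∷ bs) = countTrue bs

neqᵇ : ℕ → ℕ → Bool
neqᵇ a b = Data.Bool.not ⌊ a ℕ.≟ b ⌋

-- da(S) = #{ i : 1 ≤ i ≤ m/2, a_i ≠ a_{m+1-i} }, m = length S
da : List ℕ → ℕ
da S = countTrue (zipWith neqᵇ (take h S) (take h (reverse S)))
  where h = length S / 2

-- Formal power series in t, x, z with integer coefficients ------------------
-- A series is its coefficient function: f d m n = [t^d x^m z^n] f.

FPS : Set
FPS = ℕ → ℕ → ℕ → ℤ

sumTo : ℕ → (ℕ → ℤ) → ℤ
sumTo zero    g = g 0
sumTo (suc n) g = sumTo n g ℤ.+ g (suc n)

_⊕_ : FPS → FPS → FPS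
(f ⊕ g) d m n = f d m n ℤ.+ g d m n

_⊖_ : FPS → FPS → FPS
(f ⊖ g) d m n = f d m n ℤ.- g d m n

_⊗_ : FPS → FPS → FPS
(f ⊗ g) d m n =
  sumTo d λ i → sumTo m λ j → sumTo n λ k →
    f i j k ℤ.* g (d ∸ i) (m ∸ j) (n ∸ k)

infixl 6 _⊕_ _⊖_
infixl 7 _⊗_

δ : ℕ → ℕ → ℤ
δ a b = if ⌊ a ℕ.≟ b ⌋ then + 1 else + 0
  where open import Data.Bool using (if_then_else_)

const : ℤ → FPS
const c d m n = if ⌊ d ℕ.≟ 0 ⌋ Data.Bool.∧ ⌊ m ℕ.≟ 0 ⌋ Data.Bool.∧ ⌊ n ℕ.≟ 0 ⌋
                then c else + 0
  where open import Data.Bool using (if_then_else_)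

𝟙 : FPS
𝟙 = const (+ 1)

𝟚 : FPS
𝟚 = const (+ 2)

tᵛ xᵛ zᵛ : FPS
tᵛ d m n = δ d 1 ℤ.* δ m 0 ℤ.* δ n 0
xᵛ d m n = δ d 0 ℤ.* δ m 1 ℤ.* δ n 0
zᵛ d m n = δ d 0 ℤ.* δ m 0 ℤ.* δ n 1

K : FPS
K d m n = + length (filter (λ S → length S ℕ.≟ m ×-dec da S ℕ.≟ d) (compositions n))

numer : FPS
numer = (𝟙 ⊖ zᵛ ⊕ xᵛ ⊗ zᵛ) ⊗ (𝟙 ⊖ zᵛ ⊗ zᵛ)

denom : FPS
denom = (𝟙 ⊖ zᵛ) ⊗ (𝟙 ⊖ (𝟙 ⊕ xᵛ ⊗ xᵛ) ⊗ (zᵛ ⊗ zᵛ))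
        ⊖ 𝟚 ⊗ tᵛ ⊗ (xᵛ ⊗ xᵛ) ⊗ (zᵛ ⊗ zᵛ ⊗ zᵛ)

{-# OPTIONS --safe #-}

-- A composition with m + 2 parts is a ∷ S ++ [ b ] with S a composition with m parts, and
-- da (a ∷ S ++ [ b ]) = da S + [a ≠ b]. Lowering both outer parts by one when both exceed 1,
-- the numbers F, G, T of compositions of n with (m + 2 parts, da = d), (m parts, da = d) and
-- (m parts, da = d - 1) satisfy F (n + 2) = F n + G n + 2 Σ_{s<n} T s, that is
-- (1 - z)(1 - z²) F = z²(1 - z) G + 2 z³ T: the coefficient of tᵈ x^(m+2) in K · denom = numer.
-- The coefficients of x⁰ and x¹ follow from K = 1 + xz/(1 - z) + O(x²). Multiplication by denom
-- is computed by expanding denom into monomials, each of which shifts coefficients.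

module Submission where

open import Defs
open import Data.Nat using (ℕ)
open import Relation.Binary.PropositionalEquality using (_≡_)

module Compositions where

  import Data.Integer as ℤ
  open import Data.Bool using (Bool; true; false; not; _∧_; if_then_else_)
  open import Data.List
    using (List; []; _∷_; [_]; _++_; length; map; concatMap; upTo; applyUpTo; filter; reverse; take; zipWith)
  open import Data.List.Properties
    using (concatMap-cong; map-++; map-∘; map-cong; map-upTo; length-++; length-reverse; reverse-++; unfold-reverse)
  open import Data.Nat using (ℕ; zero; suc; _+_; _*_; _∸_; _≤_; _≡ᵇ_; _≟_; _/_; z≤n; s≤s)
  open import Data.Nat.DivMod using (m/n≤m; m/n≡1+[m∸n]/n)
  open import Data.Nat.Induction using (<-rec)
  open import Data.Nat.ListAction using (sum)
  open import Data.Nat.ListAction.Properties using (sum-++)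
  open import Data.Nat.Properties using (+-assoc; +-comm; +-identityʳ; ≤-refl; ≤-trans; ≤-reflexive; m≤n+m; m∸n≤m)
  open import Data.Nat.Tactic.RingSolver using (solve-∀)
  open import Function using (_∘_)
  open import Relation.Binary.PropositionalEquality using (_≡_; refl; sym; trans; cong; cong₂; module ≡-Reasoning)
  open import Relation.Nullary using (does)
  open import Relation.Nullary.Decidable using (_×-dec_; isYes≗does)
  open import Level using (0ℓ)
  open import Relation.Unary using (Pred; Decidable)

  -- ∑₂ n f = Σ_{a + r = n} f a r  and  ∑₃ n h = Σ_{a + b + s = n} h a b s
  ∑₂ : ℕ → (ℕ → ℕ → ℕ) → ℕ
  ∑₂ zero    f = f 0 0
  ∑₂ (suc n) f = f 0 (suc n) + ∑₂ n (λ a → f (suc a))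

  ∑₃ : ℕ → (ℕ → ℕ → ℕ → ℕ) → ℕ
  ∑₃ n h = ∑₂ n (λ a r → ∑₂ r (h a))

  ∑< : ℕ → (ℕ → ℕ) → ℕ
  ∑< zero    f = 0
  ∑< (suc n) f = ∑< n f + f n

  ∑₂-cong : ∀ n {f g : ℕ → ℕ → ℕ} → (∀ a r → a + r ≡ n → f a r ≡ g a r) → ∑₂ n f ≡ ∑₂ n g
  ∑₂-cong zero    eq = eq 0 0 refl
  ∑₂-cong (suc n) eq = cong₂ _+_ (eq 0 (suc n) refl) (∑₂-cong n λ a r p → eq (suc a) r (cong suc p))

  ∑₂-zero : ∀ n → ∑₂ n (λ _ _ → 0) ≡ 0
  ∑₂-zero zero    = refl
  ∑₂-zero (suc n) = ∑₂-zero n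

  ∑₂-last : ∀ n f → ∑₂ (suc n) f ≡ ∑₂ n (λ a r → f a (suc r)) + f (suc n) 0
  ∑₂-last zero    f = refl
  ∑₂-last (suc n) f = trans (cong (f 0 (suc (suc n)) +_) (∑₂-last n (λ a → f (suc a))))
                            (sym (+-assoc (f 0 (suc (suc n))) _ _))

  ∑₂-const : ∀ n (f : ℕ → ℕ) → ∑₂ n (λ _ → f) ≡ ∑< (suc n) f
  ∑₂-const zero    f = refl
  ∑₂-const (suc n) f = trans (cong (f (suc n) +_) (∑₂-const n f)) (+-comm (f (suc n)) _)

  ∑₃-cong : ∀ n {h k : ℕ → ℕ → ℕ → ℕ} → (∀ a b s → h a b s ≡ k a b s) → ∑₃ n h ≡ ∑₃ n k
  ∑₃-cong n eq = ∑₂-cong n λ a r _ → ∑₂-cong r λ b s _ → eq a b s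

  ∑₃-zero : ∀ n → ∑₃ n (λ _ _ _ → 0) ≡ 0
  ∑₃-zero n = trans (∑₂-cong n λ _ r _ → ∑₂-zero r) (∑₂-zero n)

  mutual
    ∑₃-peelʳ : ∀ n h → ∑₃ (suc n) h ≡ ∑₂ (suc n) (λ a → h a 0) + ∑₃ n (λ a b → h a (suc b))
    ∑₃-peelʳ zero    h = swap (h 0 0 1) (h 0 1 0) (h 1 0 0)
      where
      swap : ∀ x y z → x + y + z ≡ x + z + y
      swap = solve-∀
    ∑₃-peelʳ (suc n) h = trans (∑₃-corner n h) (swap (h 0 0 (2 + n)) _ _ _)
      where
      swap : ∀ x b a r → x + b + (a + r) ≡ x + a + (b + r)
      swap = solve-∀

    ∑₃-corner : ∀ n h → ∑₃ (2 + n) h ≡ h 0 0 (2 + n) + ∑₂ (suc n) (λ b → h 0 (suc b))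
                                       + (∑₂ (suc n) (λ a → h (suc a) 0) + ∑₃ n (λ a b → h (suc a) (suc b)))
    ∑₃-corner n h = cong (h 0 0 (2 + n) + ∑₂ (suc n) (λ b → h 0 (suc b)) +_) (∑₃-peelʳ n (λ a → h (suc a)))

  ∑₃-swap : ∀ n h → ∑₃ n h ≡ ∑₃ n (λ a b → h b a)
  ∑₃-swap zero    h = refl
  ∑₃-swap (suc n) h = trans (cong (∑₂ (suc n) (h 0) +_) (∑₃-swap n (λ a → h (suc a))))
                            (sym (∑₃-peelʳ n (λ a b → h b a)))

  count : (List ℕ → ℕ) → ℕ → ℕ
  count W n = sum (map W (compositions n))

  count-cong : ∀ {W V : List ℕ → ℕ} → (∀ S → W S ≡ V S) → ∀ n → count W n ≡ count V n
  count-cong eq n = cong sum (map-cong eq (compositions n))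

  count-zero : ∀ {W : List ℕ → ℕ} → (∀ S → W S ≡ 0) → ∀ n → count W n ≡ 0
  count-zero {W} eq n = go (compositions n)
    where
    go : ∀ Ss → sum (map W Ss) ≡ 0
    go []       = refl
    go (S ∷ Ss) = cong₂ _+_ (eq S) (go Ss)

  compsFuel-irrelevant : ∀ {f g} n → n ≤ f → n ≤ g → compsFuel f n ≡ compsFuel g n
  compsFuel-irrelevant zero    _         _         = refl
  compsFuel-irrelevant {suc f} {suc g} (suc n) (s≤s n≤f) (s≤s n≤g) = concatMap-cong tails (upTo (suc n))
    where
    tails : ∀ a → map (suc a ∷_) (compsFuel f (n ∸ a)) ≡ map (suc a ∷_) (compsFuel g (n ∸ a))
    tails a = cong (map (suc a ∷_))
      (compsFuel-irrelevant (n ∸ a) (≤-trans (m∸n≤m n a) n≤f) (≤-trans (m∸n≤m n a) n≤g))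

  sum-map-concatMap : ∀ {A B : Set} (W : B → ℕ) (F : A → List B) xs
                    → sum (map W (concatMap F xs)) ≡ sum (map (λ x → sum (map W (F x))) xs)
  sum-map-concatMap W F []       = refl
  sum-map-concatMap W F (x ∷ xs) =
    trans (cong sum (map-++ W (F x) (concatMap F xs)))
          (trans (sum-++ (map W (F x)) _) (cong (sum (map W (F x)) +_) (sum-map-concatMap W F xs)))

  sum-upTo-antidiagonal : ∀ n (g : ℕ → ℕ → ℕ) → sum (map (λ a → g a (n ∸ a)) (upTo (suc n))) ≡ ∑₂ n g
  sum-upTo-antidiagonal n g = trans (cong sum (map-upTo (λ a → g a (n ∸ a)) (suc n))) (go n g)
    where
    go : ∀ n (g : ℕ → ℕ → ℕ) → sum (applyUpTo (λ a → g a (n ∸ a)) (suc n)) ≡ ∑₂ n g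
    go zero    g = +-identityʳ (g 0 0)
    go (suc n) g = cong (g 0 (suc n) +_) (go n (λ a → g (suc a)))

  count-firstPart : ∀ n W → count W (suc n) ≡ ∑₂ n (λ a → count (λ S → W (suc a ∷ S)))
  count-firstPart n W = begin
    count W (suc n)
      ≡⟨ sum-map-concatMap W firstPart (upTo (suc n)) ⟩
    sum (map (λ a → sum (map W (firstPart a))) (upTo (suc n)))
      ≡⟨ cong sum (map-cong rest (upTo (suc n))) ⟩
    sum (map (λ a → count (λ S → W (suc a ∷ S)) (n ∸ a)) (upTo (suc n)))
      ≡⟨ sum-upTo-antidiagonal n (λ a → count (λ S → W (suc a ∷ S))) ⟩
    ∑₂ n (λ a → count (λ S → W (suc a ∷ S))) ∎
    where
    open ≡-Reasoning
    firstPart : ℕ → List (List ℕ)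
    firstPart a = map (suc a ∷_) (compsFuel n (n ∸ a))
    rest : ∀ a → sum (map W (firstPart a)) ≡ count (λ S → W (suc a ∷ S)) (n ∸ a)
    rest a = trans (cong sum (sym (map-∘ (compsFuel n (n ∸ a)))))
                   (cong (sum ∘ map (λ S → W (suc a ∷ S))) (compsFuel-irrelevant (n ∸ a) (m∸n≤m n a) ≤-refl))

  wrapCount : (List ℕ → ℕ) → ℕ → ℕ → ℕ → ℕ
  wrapCount W a b = count (λ S → W (suc a ∷ S ++ [ suc b ]))

  LastPart : ℕ → Set
  LastPart n = ∀ V → count V (suc n) ≡ ∑₂ n (λ b → count (λ S → V (S ++ [ suc b ])))

  count-wrap′ : ∀ n → (∀ r → r ≤ n → LastPart r) → ∀ W → count W (2 + n) ≡ ∑₃ n (wrapCount W) + W [ 2 + n ]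
  count-wrap′ n lastPart W = begin
    count W (2 + n)
      ≡⟨ count-firstPart (suc n) W ⟩
    ∑₂ (suc n) (λ a → count (λ S → W (suc a ∷ S)))
      ≡⟨ ∑₂-last n (λ a → count (λ S → W (suc a ∷ S))) ⟩
    ∑₂ n (λ a r → count (λ S → W (suc a ∷ S)) (suc r)) + (W [ 2 + n ] + 0)
      ≡⟨ cong₂ _+_ (∑₂-cong n λ a r a+r≡n → lastPart r (≤-trans (m≤n+m r a) (≤-reflexive a+r≡n)) _)
                   (+-identityʳ _) ⟩
    ∑₃ n (wrapCount W) + W [ 2 + n ] ∎
    where open ≡-Reasoning

  count-lastPart : ∀ n → LastPart n
  count-lastPart = <-rec LastPart step
    where
    open ≡-Reasoning
    step : ∀ n → (∀ {r} → suc r ≤ n → LastPart r) → LastPart n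
    step zero    _  V = refl
    step (suc n) ih V = begin
      count V (2 + n)
        ≡⟨ count-wrap′ n (λ r r≤n → ih (s≤s r≤n)) V ⟩
      ∑₃ n (wrapCount V) + V [ 2 + n ]
        ≡⟨ cong (_+ V [ 2 + n ]) (∑₃-swap n (wrapCount V)) ⟩
      ∑₂ n (λ b r → ∑₂ r (λ a → wrapCount V a b)) + V [ 2 + n ]
        ≡⟨ cong (_+ V [ 2 + n ]) (∑₂-cong n λ b r _ → sym (count-firstPart r (λ S → V (S ++ [ suc b ])))) ⟩
      ∑₂ n (λ b r → count (λ S → V (S ++ [ suc b ])) (suc r)) + V [ 2 + n ]
        ≡⟨ cong (∑₂ n (λ b r → count (λ S → V (S ++ [ suc b ])) (suc r)) +_) (sym (+-identityʳ _)) ⟩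
      ∑₂ n (λ b r → count (λ S → V (S ++ [ suc b ])) (suc r)) + (V [ 2 + n ] + 0)
        ≡⟨ sym (∑₂-last n (λ b → count (λ S → V (S ++ [ suc b ])))) ⟩
      ∑₂ (suc n) (λ b → count (λ S → V (S ++ [ suc b ]))) ∎

  count-wrap : ∀ n W → count W (2 + n) ≡ ∑₃ n (wrapCount W) + W [ 2 + n ]
  count-wrap n = count-wrap′ n (λ r _ → count-lastPart r)

  take-++ˡ : ∀ {A : Set} n (xs ys : List A) → n ≤ length xs → take n (xs ++ ys) ≡ take n xs
  take-++ˡ zero    xs       ys _         = refl
  take-++ˡ (suc n) (x ∷ xs) ys (s≤s n≤l) = cong (x ∷_) (take-++ˡ n xs ys n≤l)

  length-wrap : ∀ x (S : List ℕ) y → length (x ∷ S ++ [ y ]) ≡ 2 + length S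
  length-wrap x S y = cong suc (trans (length-++ S) (+-comm (length S) 1))

  countTrue-neqᵇ : ∀ x y bs → countTrue (neqᵇ x y ∷ bs) ≡ (if x ≡ᵇ y then countTrue bs else suc (countTrue bs))
  countTrue-neqᵇ x y bs = trans (cong (λ b → countTrue (not b ∷ bs)) (isYes≗does (x ≟ y))) (byCases (x ≡ᵇ y))
    where
    byCases : ∀ b → countTrue (not b ∷ bs) ≡ (if b then countTrue bs else suc (countTrue bs))
    byCases true  = refl
    byCases false = refl

  da-wrap : ∀ x (S : List ℕ) y → da (x ∷ S ++ [ y ]) ≡ (if x ≡ᵇ y then da S else suc (da S))
  da-wrap x S y = begin
    da L
      ≡⟨ cong (λ k → countTrue (zipWith neqᵇ (take k L) (take k (reverse L)))) half ⟩
    countTrue (zipWith neqᵇ (take (suc h) L) (take (suc h) (reverse L)))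
      ≡⟨ cong (λ R → countTrue (zipWith neqᵇ (take (suc h) L) (take (suc h) R))) reverse-wrap ⟩
    countTrue (neqᵇ x y ∷ zipWith neqᵇ (take h (S ++ [ y ])) (take h (reverse S ++ [ x ])))
      ≡⟨ cong₂ (λ A B → countTrue (neqᵇ x y ∷ zipWith neqᵇ A B))
               (take-++ˡ h S [ y ] h≤|S|)
               (take-++ˡ h (reverse S) [ x ] (≤-trans h≤|S| (≤-reflexive (sym (length-reverse S))))) ⟩
    countTrue (neqᵇ x y ∷ zipWith neqᵇ (take h S) (take h (reverse S)))
      ≡⟨ countTrue-neqᵇ x y (zipWith neqᵇ (take h S) (take h (reverse S))) ⟩
    (if x ≡ᵇ y then da S else suc (da S)) ∎
    where
    open ≡-Reasoning
    L = x ∷ S ++ [ y ]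
    h = length S / 2
    h≤|S| : h ≤ length S
    h≤|S| = m/n≤m (length S) 2
    half : length L / 2 ≡ suc h
    half = trans (cong (_/ 2) (length-wrap x S y)) (m/n≡1+[m∸n]/n {2 + length S} {2} (s≤s (s≤s z≤n)))
    reverse-wrap : reverse L ≡ y ∷ reverse S ++ [ x ]
    reverse-wrap = trans (unfold-reverse x (S ++ [ y ])) (cong (_++ [ x ]) (reverse-++ S [ y ]))

  statWeight : (ℕ → ℕ → Bool) → List ℕ → ℕ
  statWeight p S = if p (length S) (da S) then 1 else 0

  statCount : (ℕ → ℕ → Bool) → ℕ → ℕ
  statCount p = count (statWeight p)

  hasStats : ℕ → ℕ → ℕ → ℕ → Bool
  hasStats m d l e = (l ≡ᵇ m) ∧ (e ≡ᵇ d)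

  length-filter : ∀ {A : Set} {P : Pred A 0ℓ} (P? : Decidable P) xs
                → length (filter P? xs) ≡ sum (map (λ x → if does (P? x) then 1 else 0) xs)
  length-filter P? []       = refl
  length-filter P? (x ∷ xs) with does (P? x)
  ... | true  = cong suc (length-filter P? xs)
  ... | false = length-filter P? xs

  K≡statCount : ∀ d m n → K d m n ≡ ℤ.+ statCount (hasStats m d) n
  K≡statCount d m n = cong ℤ.+_ (length-filter (λ S → length S ≟ m ×-dec da S ≟ d) (compositions n))

  statCount-false : ∀ {p} → (∀ l e → p l e ≡ false) → ∀ n → statCount p n ≡ 0
  statCount-false p≡false = count-zero (λ S → cong (λ b → if b then 1 else 0) (p≡false (length S) (da S)))

  statCount-wrap : ∀ p x y s → count (λ S → statWeight p (x ∷ S ++ [ y ])) s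
                             ≡ statCount (λ l e → p (2 + l) (if x ≡ᵇ y then e else suc e)) s
  statCount-wrap p x y = count-cong λ S →
    cong₂ (λ l e → if p l e then 1 else 0) (length-wrap x S y) (da-wrap x S y)

  statCount-noParts : ∀ d n → statCount (hasStats 0 d) (suc n) ≡ 0
  statCount-noParts d n = trans (count-firstPart n (statWeight (hasStats 0 d)))
                                (trans (∑₂-cong n λ _ r _ → count-zero (λ _ → refl) r) (∑₂-zero n))

  statCount-onePart : ∀ d n → statCount (hasStats 1 d) (suc n) ≡ (if 0 ≡ᵇ d then 1 else 0)
  statCount-onePart d zero    = +-identityʳ _
  statCount-onePart d (suc n) = trans (count-wrap n (statWeight (hasStats 1 d)))
    (cong (_+ (if 0 ≡ᵇ d then 1 else 0)) (trans (∑₃-cong n wrapped-vanishes) (∑₃-zero n)))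
    where
    wrapped-vanishes : ∀ a b s → wrapCount (statWeight (hasStats 1 d)) a b s ≡ 0
    wrapped-vanishes a b s = trans (statCount-wrap (hasStats 1 d) (suc a) (suc b) s) (statCount-false (λ _ _ → refl) s)

  module WrappedCounts (m d : ℕ) where

    -- T counts da S = d - 1, and nothing when d = 0.
    F G T : ℕ → ℕ
    F = statCount (hasStats (2 + m) d)
    G = statCount (hasStats m d)
    T = statCount (λ l e → (l ≡ᵇ m) ∧ (suc e ≡ᵇ d))

    -- inner a b counts the middles S of the compositions (1 + a) ∷ S ++ [ 1 + b ] counted by F.
    inner : ℕ → ℕ → ℕ → ℕ
    inner a b = statCount (λ l e → hasStats (2 + m) d (2 + l) (if a ≡ᵇ b then e else suc e))

    F-wrap : ∀ n → F (2 + n) ≡ ∑₃ n inner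
    F-wrap n = trans (count-wrap n (statWeight (hasStats (2 + m) d)))
      (trans (+-identityʳ _) (∑₃-cong n λ a b → statCount-wrap (hasStats (2 + m) d) (suc a) (suc b)))

    -- Split by whether the outer parts are 1: both (G), exactly one (T, twice), neither (F n).
    F-step : ∀ n → F (2 + n) ≡ F n + G n + 2 * ∑< n T
    F-step zero          = trans (F-wrap 0) (sym (+-identityʳ (G 0)))
    F-step (suc zero)    = trans (F-wrap 1) (double (G 1) (T 0))
      where
      double : ∀ g t → g + t + t ≡ g + 2 * t
      double = solve-∀
    F-step (suc (suc n)) = begin
      F (4 + n)
        ≡⟨ F-wrap (2 + n) ⟩
      ∑₃ (2 + n) inner
        ≡⟨ ∑₃-corner n inner ⟩
      G (2 + n) + ∑₂ (suc n) (λ _ → T) + (∑₂ (suc n) (λ _ → T) + ∑₃ n inner)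
        ≡⟨ cong₂ (λ P R → G (2 + n) + P + (P + R)) (∑₂-const (suc n) T) (sym (F-wrap n)) ⟩
      G (2 + n) + ∑< (2 + n) T + (∑< (2 + n) T + F (2 + n))
        ≡⟨ rearrange (G (2 + n)) (∑< (2 + n) T) (F (2 + n)) ⟩
      F (2 + n) + G (2 + n) + 2 * ∑< (2 + n) T ∎
      where
      open ≡-Reasoning
      rearrange : ∀ g p f → g + p + (p + f) ≡ f + g + 2 * p
      rearrange = solve-∀

    F-recurrence : ∀ n → F (3 + n) + F n + G n ≡ F (2 + n) + F (1 + n) + G (1 + n) + 2 * T n
    F-recurrence n = begin
      F (3 + n) + F n + G n
        ≡⟨ cong (λ x → x + F n + G n) (F-step (suc n)) ⟩
      F (1 + n) + G (1 + n) + 2 * (∑< n T + T n) + F n + G n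
        ≡⟨ rearrange (F (1 + n)) (G (1 + n)) (∑< n T) (T n) (F n) (G n) ⟩
      F n + G n + 2 * ∑< n T + F (1 + n) + G (1 + n) + 2 * T n
        ≡⟨ cong (λ x → x + F (1 + n) + G (1 + n) + 2 * T n) (sym (F-step n)) ⟩
      F (2 + n) + F (1 + n) + G (1 + n) + 2 * T n ∎
      where
      open ≡-Reasoning
      rearrange : ∀ f₁ g₁ p t f₀ g₀ → f₁ + g₁ + 2 * (p + t) + f₀ + g₀ ≡ f₀ + g₀ + 2 * p + f₁ + g₁ + 2 * t
      rearrange = solve-∀

module PowerSeries where

  open import Data.Bool using (if_then_else_)
  open import Data.Integer using (ℤ; +_; -[1+_]; _+_; _*_; -_; _-_)
  open import Data.Integer.Properties
    using (+-identityʳ; +-identityˡ; +-assoc; *-identityʳ; *-zeroʳ; *-distribˡ-+; +-inverseʳ; -1*i≡-i; pos-*)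
  open import Data.Integer.Tactic.RingSolver using (solve-∀)
  open import Data.List using (List; []; _∷_; _++_)
  open import Data.Nat as ℕ using (ℕ; zero; suc; _∸_; _<_; s≤s)
  open import Data.Product using (Σ; _,_; proj₁; proj₂)
  open import Function using (_∘_)
  open import Relation.Binary.PropositionalEquality using (_≡_; _≗_; refl; sym; trans; cong; cong₂; module ≡-Reasoning)
  open import Relation.Nullary.Decidable using (isYes≗does)

  infix 4 _≗₃_

  _≗₃_ : FPS → FPS → Set
  f ≗₃ g = ∀ d m n → f d m n ≡ g d m n

  δ-suc : ∀ a b → δ (suc a) (suc b) ≡ δ a b
  δ-suc a b = cong (λ b → if b then + 1 else + 0)
                   (trans (isYes≗does (suc a ℕ.≟ suc b)) (sym (isYes≗does (a ℕ.≟ b))))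

  -- shift a X n = [zⁿ] zᵃ X  and  shift³ a b e f d m n = [tᵈ xᵐ zⁿ] tᵃ xᵇ zᵉ f
  shift : ℕ → (ℕ → ℤ) → ℕ → ℤ
  shift zero    X n       = X n
  shift (suc a) X zero    = + 0
  shift (suc a) X (suc n) = shift a X n

  shift-cong : ∀ a {X Y : ℕ → ℤ} → (∀ k → X k ≡ Y k) → ∀ n → shift a X n ≡ shift a Y n
  shift-cong zero    eq n       = eq n
  shift-cong (suc a) eq zero    = refl
  shift-cong (suc a) eq (suc n) = shift-cong a eq n

  shift-zero : ∀ a n → shift a (λ _ → + 0) n ≡ + 0
  shift-zero zero    n       = refl
  shift-zero (suc a) zero    = refl
  shift-zero (suc a) (suc n) = shift-zero a n

  shift-+ : ∀ a (X Y : ℕ → ℤ) n → shift a (λ k → X k + Y k) n ≡ shift a X n + shift a Y n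
  shift-+ zero    X Y n       = refl
  shift-+ (suc a) X Y zero    = refl
  shift-+ (suc a) X Y (suc n) = shift-+ a X Y n

  shift-*ˡ : ∀ a c (X : ℕ → ℤ) n → shift a (λ k → c * X k) n ≡ c * shift a X n
  shift-*ˡ zero    c X n       = refl
  shift-*ˡ (suc a) c X zero    = sym (*-zeroʳ c)
  shift-*ˡ (suc a) c X (suc n) = shift-*ˡ a c X n

  shift-δ : ∀ a e n → shift a (λ k → δ k e) n ≡ δ n (a ℕ.+ e)
  shift-δ zero    e n       = refl
  shift-δ (suc a) e zero    = refl
  shift-δ (suc a) e (suc n) = trans (shift-δ a e n) (sym (δ-suc n (a ℕ.+ e)))

  shift-head : ∀ e n (X : ℕ → ℤ) → X 0 * δ n e + shift (suc e) (X ∘ suc) n ≡ shift e X n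
  shift-head zero    zero    X = trans (+-identityʳ _) (*-identityʳ (X 0))
  shift-head zero    (suc n) X = trans (cong (_+ X (suc n)) (*-zeroʳ (X 0))) (+-identityˡ _)
  shift-head (suc e) zero    X = trans (+-identityʳ _) (*-zeroʳ (X 0))
  shift-head (suc e) (suc n) X = trans (cong (λ c → X 0 * c + shift (suc e) (X ∘ suc) n) (δ-suc n e)) (shift-head e n X)

  sumTo-cong : ∀ n {X Y : ℕ → ℤ} → (∀ k → X k ≡ Y k) → sumTo n X ≡ sumTo n Y
  sumTo-cong zero    eq = eq 0
  sumTo-cong (suc n) eq = cong₂ _+_ (sumTo-cong n eq) (eq (suc n))

  sumTo-zero : ∀ n → sumTo n (λ _ → + 0) ≡ + 0
  sumTo-zero zero    = refl
  sumTo-zero (suc n) = trans (+-identityʳ _) (sumTo-zero n)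

  sumTo-+ : ∀ n (X Y : ℕ → ℤ) → sumTo n (λ k → X k + Y k) ≡ sumTo n X + sumTo n Y
  sumTo-+ zero    X Y = refl
  sumTo-+ (suc n) X Y = trans (cong (_+ (X (suc n) + Y (suc n))) (sumTo-+ n X Y))
                              (interchange (sumTo n X) (sumTo n Y) (X (suc n)) (Y (suc n)))
    where
    interchange : ∀ a b c d → a + b + (c + d) ≡ a + c + (b + d)
    interchange = solve-∀

  sumTo-*ˡ : ∀ n c (X : ℕ → ℤ) → sumTo n (λ k → c * X k) ≡ c * sumTo n X
  sumTo-*ˡ zero    c X = refl
  sumTo-*ˡ (suc n) c X = trans (cong (_+ c * X (suc n)) (sumTo-*ˡ n c X)) (sym (*-distribˡ-+ c (sumTo n X) (X (suc n))))

  sumTo-front : ∀ n (X : ℕ → ℤ) → sumTo (suc n) X ≡ X 0 + sumTo n (X ∘ suc)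
  sumTo-front zero    X = refl
  sumTo-front (suc n) X = trans (cong (_+ X (2 ℕ.+ n)) (sumTo-front n X)) (+-assoc (X 0) _ _)

  sumTo-δ : ∀ n e (X : ℕ → ℤ) → sumTo n (λ k → X k * δ (n ∸ k) e) ≡ shift e X n
  sumTo-δ zero    zero    X = *-identityʳ (X 0)
  sumTo-δ zero    (suc e) X = *-zeroʳ (X 0)
  sumTo-δ (suc n) e       X =
    trans (sumTo-front n (λ k → X k * δ (suc n ∸ k) e))
          (trans (cong (λ s → X 0 * δ (suc n) e + s) (sumTo-δ n e (X ∘ suc))) (shift-head e (suc n) X))

  ∑∑∑ : ℕ → ℕ → ℕ → (ℕ → ℕ → ℕ → ℤ) → ℤ
  ∑∑∑ d m n H = sumTo d λ i → sumTo m λ j → sumTo n λ k → H i j k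

  ∑∑∑-cong : ∀ d m n {H H′ : ℕ → ℕ → ℕ → ℤ} → (∀ i j k → H i j k ≡ H′ i j k) → ∑∑∑ d m n H ≡ ∑∑∑ d m n H′
  ∑∑∑-cong d m n eq = sumTo-cong d λ i → sumTo-cong m λ j → sumTo-cong n λ k → eq i j k

  ∑∑∑-zero : ∀ d m n → ∑∑∑ d m n (λ _ _ _ → + 0) ≡ + 0
  ∑∑∑-zero d m n = trans (sumTo-cong d λ i → trans (sumTo-cong m λ j → sumTo-zero n) (sumTo-zero m)) (sumTo-zero d)

  ∑∑∑-+ : ∀ d m n H H′ → ∑∑∑ d m n (λ i j k → H i j k + H′ i j k) ≡ ∑∑∑ d m n H + ∑∑∑ d m n H′
  ∑∑∑-+ d m n H H′ =
    trans (sumTo-cong d λ i → trans (sumTo-cong m λ j → sumTo-+ n (H i j) (H′ i j)) (sumTo-+ m _ _)) (sumTo-+ d _ _)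

  ∑∑∑-*ˡ : ∀ d m n c H → ∑∑∑ d m n (λ i j k → c * H i j k) ≡ c * ∑∑∑ d m n H
  ∑∑∑-*ˡ d m n c H =
    trans (sumTo-cong d λ i → trans (sumTo-cong m λ j → sumTo-*ˡ n c (H i j)) (sumTo-*ˡ m c _)) (sumTo-*ˡ d c _)

  ⊗-cong : ∀ {f f′ g g′} → f ≗₃ f′ → g ≗₃ g′ → f ⊗ g ≗₃ f′ ⊗ g′
  ⊗-cong f≗f′ g≗g′ d m n = ∑∑∑-cong d m n λ i j k → cong₂ _*_ (f≗f′ i j k) (g≗g′ (d ∸ i) (m ∸ j) (n ∸ k))

  mono : ℕ → ℕ → ℕ → FPS
  mono a b e d m n = δ d a * δ m b * δ n e

  shift³ : ℕ → ℕ → ℕ → FPS → FPS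
  shift³ a b e f d m n = shift a (λ i → shift b (λ j → shift e (f i j) n) m) d

  ⊗-mono : ∀ f a b e → f ⊗ mono a b e ≗₃ shift³ a b e f
  ⊗-mono f a b e d m n = begin
    (f ⊗ mono a b e) d m n
      ≡⟨ sumTo-cong d (λ i → sumTo-cong m λ j → convolve-z i j) ⟩
    sumTo d (λ i → sumTo m λ j → δ (d ∸ i) a * δ (m ∸ j) b * shift e (f i j) n)
      ≡⟨ sumTo-cong d convolve-x ⟩
    sumTo d (λ i → shift b (λ j → shift e (f i j) n) m * δ (d ∸ i) a)
      ≡⟨ sumTo-δ d a _ ⟩
    shift³ a b e f d m n ∎
    where
    open ≡-Reasoning
    convolve-z : ∀ i j → sumTo n (λ k → f i j k * (δ (d ∸ i) a * δ (m ∸ j) b * δ (n ∸ k) e))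
                       ≡ δ (d ∸ i) a * δ (m ∸ j) b * shift e (f i j) n
    convolve-z i j = trans (sumTo-cong n λ k → reorder (f i j k) (δ (d ∸ i) a * δ (m ∸ j) b) (δ (n ∸ k) e))
                           (trans (sumTo-*ˡ n (δ (d ∸ i) a * δ (m ∸ j) b) (λ k → f i j k * δ (n ∸ k) e))
                                  (cong (δ (d ∸ i) a * δ (m ∸ j) b *_) (sumTo-δ n e (f i j))))
      where
      reorder : ∀ x y z → x * (y * z) ≡ y * (x * z)
      reorder = solve-∀
    convolve-x : ∀ i → sumTo m (λ j → δ (d ∸ i) a * δ (m ∸ j) b * shift e (f i j) n)
                     ≡ shift b (λ j → shift e (f i j) n) m * δ (d ∸ i) a
    convolve-x i = trans (sumTo-cong m λ j → reorder (δ (d ∸ i) a) (δ (m ∸ j) b) (shift e (f i j) n))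
                         (trans (sumTo-*ˡ m (δ (d ∸ i) a) (λ j → shift e (f i j) n * δ (m ∸ j) b))
                                (trans (cong (δ (d ∸ i) a *_) (sumTo-δ m b (λ j → shift e (f i j) n)))
                                       (commute (δ (d ∸ i) a) _)))
      where
      reorder : ∀ x y z → x * y * z ≡ x * (z * y)
      reorder = solve-∀
      commute : ∀ x y → x * y ≡ y * x
      commute = solve-∀

  shift³-zero : ∀ a b e → shift³ a b e (λ _ _ _ → + 0) ≗₃ λ _ _ _ → + 0
  shift³-zero a b e d m n =
    trans (shift-cong a (λ i → trans (shift-cong b (λ j → shift-zero e n) m) (shift-zero b m)) d) (shift-zero a d)

  shift³-+ : ∀ a b e F G → shift³ a b e (λ i j k → F i j k + G i j k)
                         ≗₃ λ d m n → shift³ a b e F d m n + shift³ a b e G d m n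
  shift³-+ a b e F G d m n =
    trans (shift-cong a (λ i → trans (shift-cong b (λ j → shift-+ e (F i j) (G i j) n) m) (shift-+ b _ _ m)) d)
          (shift-+ a _ _ d)

  shift³-*ˡ : ∀ a b e c F → shift³ a b e (λ i j k → c * F i j k) ≗₃ λ d m n → c * shift³ a b e F d m n
  shift³-*ˡ a b e c F d m n =
    trans (shift-cong a (λ i → trans (shift-cong b (λ j → shift-*ˡ e c (F i j) n) m) (shift-*ˡ b c _ m)) d)
          (shift-*ˡ a c _ d)

  shift³-mono : ∀ a b e a₀ b₀ e₀ → shift³ a b e (mono a₀ b₀ e₀) ≗₃ mono (a ℕ.+ a₀) (b ℕ.+ b₀) (e ℕ.+ e₀)
  shift³-mono a b e a₀ b₀ e₀ d m n = begin
    shift a (λ i → shift b (λ j → shift e (λ k → δ i a₀ * δ j b₀ * δ k e₀) n) m) d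
      ≡⟨ shift-cong a (λ i → shift-cong b (λ j → shift-scaled-δ e (δ i a₀ * δ j b₀) e₀ n) m) d ⟩
    shift a (λ i → shift b (λ j → δ i a₀ * δ j b₀ * Z) m) d
      ≡⟨ shift-cong a (λ i → trans (shift-cong b (λ j → pull (δ i a₀) (δ j b₀) Z) m)
                                   (shift-scaled-δ b (δ i a₀ * Z) b₀ m)) d ⟩
    shift a (λ i → δ i a₀ * Z * X) d
      ≡⟨ trans (shift-cong a (λ i → rotate (δ i a₀) Z X) d) (shift-scaled-δ a (Z * X) a₀ d) ⟩
    Z * X * δ d (a ℕ.+ a₀)
      ≡⟨ reverse Z X (δ d (a ℕ.+ a₀)) ⟩
    δ d (a ℕ.+ a₀) * X * Z ∎
    where
    open ≡-Reasoning
    Z = δ n (e ℕ.+ e₀)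
    X = δ m (b ℕ.+ b₀)
    shift-scaled-δ : ∀ a c e n → shift a (λ k → c * δ k e) n ≡ c * δ n (a ℕ.+ e)
    shift-scaled-δ a c e n = trans (shift-*ˡ a c (λ k → δ k e) n) (cong (c *_) (shift-δ a e n))
    pull : ∀ x y z → x * y * z ≡ x * z * y
    pull = solve-∀
    rotate : ∀ x y z → x * y * z ≡ y * z * x
    rotate = solve-∀
    reverse : ∀ x y z → x * y * z ≡ z * y * x
    reverse = solve-∀

  data Term : Set where
    term : ℤ → ℕ → ℕ → ℕ → Term

  poly : List Term → FPS
  poly []                 _ _ _ = + 0
  poly (term c a b e ∷ L) d m n = c * mono a b e d m n + poly L d m n

  shiftSum : FPS → List Term → FPS
  shiftSum f []                 _ _ _ = + 0
  shiftSum f (term c a b e ∷ L) d m n = c * shift³ a b e f d m n + shiftSum f L d m n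

  ⊗-poly : ∀ f L → f ⊗ poly L ≗₃ shiftSum f L
  ⊗-poly f []                 d m n = trans (∑∑∑-cong d m n λ i j k → *-zeroʳ (f i j k)) (∑∑∑-zero d m n)
  ⊗-poly f (term c a b e ∷ L) d m n = begin
    (f ⊗ poly (term c a b e ∷ L)) d m n
      ≡⟨ ∑∑∑-cong d m n (λ i j k → distribute (f i j k) c (M i j k) (poly L (d ∸ i) (m ∸ j) (n ∸ k))) ⟩
    ∑∑∑ d m n (λ i j k → c * (f i j k * M i j k) + f i j k * poly L (d ∸ i) (m ∸ j) (n ∸ k))
      ≡⟨ ∑∑∑-+ d m n _ _ ⟩
    ∑∑∑ d m n (λ i j k → c * (f i j k * M i j k)) + (f ⊗ poly L) d m n
      ≡⟨ cong₂ _+_ (trans (∑∑∑-*ˡ d m n c _) (cong (c *_) (⊗-mono f a b e d m n))) (⊗-poly f L d m n) ⟩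
    shiftSum f (term c a b e ∷ L) d m n ∎
    where
    open ≡-Reasoning
    M : ℕ → ℕ → ℕ → ℤ
    M i j k = mono a b e (d ∸ i) (m ∸ j) (n ∸ k)
    distribute : ∀ x c y z → x * (c * y + z) ≡ c * (x * y) + x * z
    distribute = solve-∀

  scale : ℤ → List Term → List Term
  scale c []                  = []
  scale c (term c′ a b e ∷ L) = term (c * c′) a b e ∷ scale c L

  shiftTerms : ℕ → ℕ → ℕ → List Term → List Term
  shiftTerms a b e []                    = []
  shiftTerms a b e (term c a₀ b₀ e₀ ∷ L) = term c (a ℕ.+ a₀) (b ℕ.+ b₀) (e ℕ.+ e₀) ∷ shiftTerms a b e L

  mulTerms : List Term → List Term → List Term
  mulTerms L []                 = []
  mulTerms L (term c a b e ∷ L′) = scale c (shiftTerms a b e L) ++ mulTerms L L′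

  poly-++ : ∀ L L′ → poly (L ++ L′) ≗₃ λ d m n → poly L d m n + poly L′ d m n
  poly-++ []                 L′ d m n = sym (+-identityˡ _)
  poly-++ (term c a b e ∷ L) L′ d m n =
    trans (cong (λ s → c * mono a b e d m n + s) (poly-++ L L′ d m n)) (sym (+-assoc (c * mono a b e d m n) _ _))

  poly-scale : ∀ c L → poly (scale c L) ≗₃ λ d m n → c * poly L d m n
  poly-scale c []                  d m n = sym (*-zeroʳ c)
  poly-scale c (term c′ a b e ∷ L) d m n =
    trans (cong (λ s → c * c′ * mono a b e d m n + s) (poly-scale c L d m n)) (factor c c′ (mono a b e d m n) (poly L d m n))
    where
    factor : ∀ c c′ y z → c * c′ * y + c * z ≡ c * (c′ * y + z)
    factor = solve-∀

  shift³-poly : ∀ a b e L → shift³ a b e (poly L) ≗₃ poly (shiftTerms a b e L)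
  shift³-poly a b e []                    = shift³-zero a b e
  shift³-poly a b e (term c a₀ b₀ e₀ ∷ L) d m n =
    trans (shift³-+ a b e (λ i j k → c * mono a₀ b₀ e₀ i j k) (poly L) d m n)
          (cong₂ _+_ (trans (shift³-*ˡ a b e c (mono a₀ b₀ e₀) d m n)
                            (cong (c *_) (shift³-mono a b e a₀ b₀ e₀ d m n)))
                     (shift³-poly a b e L d m n))

  poly-mul : ∀ L L′ → poly L ⊗ poly L′ ≗₃ poly (mulTerms L L′)
  poly-mul L L′ d m n = trans (⊗-poly (poly L) L′ d m n) (expand L′)
    where
    expand : ∀ L′ → shiftSum (poly L) L′ d m n ≡ poly (mulTerms L L′) d m n
    expand []                  = refl
    expand (term c a b e ∷ L′) =
      trans (cong₂ _+_ (trans (cong (c *_) (shift³-poly a b e L d m n)) (sym (poly-scale c (shiftTerms a b e L) d m n)))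
                       (expand L′))
            (sym (poly-++ (scale c (shiftTerms a b e L)) (mulTerms L L′) d m n))

  Polynomial : FPS → Set
  Polynomial f = Σ (List Term) λ L → f ≗₃ poly L

  monoᵖ : ∀ a b e → Polynomial (mono a b e)
  monoᵖ a b e = term (+ 1) a b e ∷ [] , λ d m n → unit (mono a b e d m n)
    where
    unit : ∀ x → x ≡ + 1 * x + + 0
    unit = solve-∀

  constᵖ : ∀ c → Polynomial (const c)
  constᵖ c = term c 0 0 0 ∷ [] , coefficients
    where
    unit : ∀ c → c ≡ c * + 1 + + 0
    unit = solve-∀
    vanishes : ∀ c → + 0 ≡ c * + 0 + + 0
    vanishes = solve-∀
    coefficients : const c ≗₃ poly (term c 0 0 0 ∷ [])
    coefficients zero    zero    zero    = unit c
    coefficients zero    zero    (suc n) = vanishes c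
    coefficients zero    (suc m) n       = vanishes c
    coefficients (suc d) m       n       = vanishes c

  _⊕ᵖ_ : ∀ {f g} → Polynomial f → Polynomial g → Polynomial (f ⊕ g)
  (L , f≗) ⊕ᵖ (L′ , g≗) = L ++ L′ , λ d m n → trans (cong₂ _+_ (f≗ d m n) (g≗ d m n)) (sym (poly-++ L L′ d m n))

  _⊖ᵖ_ : ∀ {f g} → Polynomial f → Polynomial g → Polynomial (f ⊖ g)
  (L , f≗) ⊖ᵖ (L′ , g≗) = L ++ scale -[1+ 0 ] L′ , λ d m n →
    trans (cong₂ _-_ (f≗ d m n) (g≗ d m n))
          (trans (cong (λ s → poly L d m n + s) (trans (sym (-1*i≡-i _)) (sym (poly-scale -[1+ 0 ] L′ d m n))))
                 (sym (poly-++ L (scale -[1+ 0 ] L′) d m n)))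

  _⊗ᵖ_ : ∀ {f g} → Polynomial f → Polynomial g → Polynomial (f ⊗ g)
  (L , f≗) ⊗ᵖ (L′ , g≗) = mulTerms L L′ , λ d m n → trans (⊗-cong f≗ g≗ d m n) (poly-mul L L′ d m n)

  infixl 6 _⊕ᵖ_ _⊖ᵖ_
  infixl 7 _⊗ᵖ_

  denomᵖ : Polynomial denom
  denomᵖ = (𝟙ᵖ ⊖ᵖ zᵖ) ⊗ᵖ (𝟙ᵖ ⊖ᵖ (𝟙ᵖ ⊕ᵖ xᵖ ⊗ᵖ xᵖ) ⊗ᵖ (zᵖ ⊗ᵖ zᵖ))
           ⊖ᵖ constᵖ (+ 2) ⊗ᵖ monoᵖ 1 0 0 ⊗ᵖ (xᵖ ⊗ᵖ xᵖ) ⊗ᵖ (zᵖ ⊗ᵖ zᵖ ⊗ᵖ zᵖ)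
    where
    𝟙ᵖ = constᵖ (+ 1)
    xᵖ = monoᵖ 0 1 0
    zᵖ = monoᵖ 0 0 1

  numerᵖ : Polynomial numer
  numerᵖ = (𝟙ᵖ ⊖ᵖ zᵖ ⊕ᵖ xᵖ ⊗ᵖ zᵖ) ⊗ᵖ (𝟙ᵖ ⊖ᵖ zᵖ ⊗ᵖ zᵖ)
    where
    𝟙ᵖ = constᵖ (+ 1)
    xᵖ = monoᵖ 0 1 0
    zᵖ = monoᵖ 0 0 1

  -- Δ X n = [zⁿ] (1 - z)(1 - z²) X
  Δ : (ℕ → ℤ) → ℕ → ℤ
  Δ X n = X n - shift 1 X n - shift 2 X n + shift 3 X n

  denomExpansion : FPS → FPS
  denomExpansion f d m n = Δ (f d m) n - shift³ 0 2 2 f d m n + shift³ 0 2 3 f d m n - + 2 * shift³ 1 2 3 f d m n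

  ⊗-denom : ∀ f → f ⊗ denom ≗₃ denomExpansion f
  ⊗-denom f d m n =
    trans (⊗-cong {f} {f} (λ _ _ _ → refl) (proj₂ denomᵖ) d m n)
          (trans (⊗-poly f (proj₁ denomᵖ) d m n)
                 (collect (f d m n) (shift 1 (f d m) n) (shift 2 (f d m) n) (shift 3 (f d m) n)
                          (shift³ 0 2 2 f d m n) (shift³ 0 2 3 f d m n) (shift³ 1 2 3 f d m n)))
    where
    -- the left-hand side is the normal form of shiftSum f (proj₁ denomᵖ) d m n
    collect : ∀ a b c e g h t → + 1 * a + (- + 1 * b + (- + 1 * c + (+ 1 * e + (- + 1 * g + (+ 1 * h + (- + 2 * t + + 0))))))
                              ≡ a - b - c + e - g + h - + 2 * t
    collect = solve-∀

  numerExpansion : FPS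
  numerExpansion d m n =
    mono 0 0 0 d m n - mono 0 0 1 d m n + mono 0 1 1 d m n - mono 0 0 2 d m n + mono 0 0 3 d m n - mono 0 1 3 d m n

  numer-expansion : numer ≗₃ numerExpansion
  numer-expansion d m n =
    trans (proj₂ numerᵖ d m n)
          (collect (mono 0 0 0 d m n) (mono 0 0 1 d m n) (mono 0 1 1 d m n) (mono 0 0 2 d m n) (mono 0 0 3 d m n) (mono 0 1 3 d m n))
    where
    collect : ∀ a b c e g h → + 1 * a + (- + 1 * b + (+ 1 * c + (- + 1 * e + (+ 1 * g + (- + 1 * h + + 0)))))
                            ≡ a - b + c - e + g - h
    collect = solve-∀

  isSuc : ℕ → ℤ
  isSuc zero    = + 0
  isSuc (suc _) = + 1

  Δ-cong : ∀ {X Y : ℕ → ℤ} → X ≗ Y → Δ X ≗ Δ Y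
  Δ-cong {X} {Y} X≗Y n = begin
    X n - shift 1 X n - shift 2 X n + shift 3 X n
      ≡⟨ cong₂ (λ a b → a - b - shift 2 X n + shift 3 X n) (X≗Y n) (shift-cong 1 X≗Y n) ⟩
    Y n - shift 1 Y n - shift 2 X n + shift 3 X n
      ≡⟨ cong₂ (λ a b → Y n - shift 1 Y n - a + b) (shift-cong 2 X≗Y n) (shift-cong 3 X≗Y n) ⟩
    Y n - shift 1 Y n - shift 2 Y n + shift 3 Y n ∎
    where open ≡-Reasoning

  Δ-*ˡ : ∀ c (X : ℕ → ℤ) n → Δ (λ k → c * X k) n ≡ c * Δ X n
  Δ-*ˡ c X n = begin
    c * X n - shift 1 (λ k → c * X k) n - shift 2 (λ k → c * X k) n + shift 3 (λ k → c * X k) n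
      ≡⟨ cong₂ (λ a b → c * X n - a - b + shift 3 (λ k → c * X k) n) (shift-*ˡ 1 c X n) (shift-*ˡ 2 c X n) ⟩
    c * X n - c * shift 1 X n - c * shift 2 X n + shift 3 (λ k → c * X k) n
      ≡⟨ cong (λ a → c * X n - c * shift 1 X n - c * shift 2 X n + a) (shift-*ˡ 3 c X n) ⟩
    c * X n - c * shift 1 X n - c * shift 2 X n + c * shift 3 X n
      ≡⟨ factor c (X n) (shift 1 X n) (shift 2 X n) (shift 3 X n) ⟩
    c * Δ X n ∎
    where
    open ≡-Reasoning
    factor : ∀ c x y z w → c * x - c * y - c * z + c * w ≡ c * (x - y - z + w)
    factor = solve-∀

  Δ-δ₀ : ∀ n → Δ (λ k → δ k 0) n ≡ δ n 0 - δ n 1 - δ n 2 + δ n 3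
  Δ-δ₀ 0                         = refl
  Δ-δ₀ 1                         = refl
  Δ-δ₀ 2                         = refl
  Δ-δ₀ 3                         = refl
  Δ-δ₀ (suc (suc (suc (suc n)))) = refl

  Δ-isSuc : ∀ n → Δ isSuc n ≡ δ n 1 - δ n 3
  Δ-isSuc 0                         = refl
  Δ-isSuc 1                         = refl
  Δ-isSuc 2                         = refl
  Δ-isSuc 3                         = refl
  Δ-isSuc (suc (suc (suc (suc n)))) = refl

  private
    drop-zeros : ∀ x → x - + 0 + + 0 - + 2 * + 0 ≡ x
    drop-zeros = solve-∀

  denomExpansion-fewParts : ∀ f d m n → m < 2 → denomExpansion f d m n ≡ Δ (f d m) n
  denomExpansion-fewParts f d 0 n _ = trans (cong (λ w → Δ (f d 0) n - + 0 + + 0 - + 2 * w) (shift-zero 1 d)) (drop-zeros _)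
  denomExpansion-fewParts f d 1 n _ = trans (cong (λ w → Δ (f d 1) n - + 0 + + 0 - + 2 * w) (shift-zero 1 d)) (drop-zeros _)
  denomExpansion-fewParts f d (suc (suc m)) n (s≤s (s≤s ()))

  -- [zⁿ] of (1 - z)(1 - z²) X - z²(1 - z) Y - 2 z³ W
  wrapSlice : (X Y W : ℕ → ℤ) → ℕ → ℤ
  wrapSlice X Y W n = Δ X n - shift 2 Y n + shift 3 Y n - + 2 * shift 3 W n

  wrapSlice-cong : ∀ {X X′ Y Y′ W W′ : ℕ → ℤ} → X ≗ X′ → Y ≗ Y′ → W ≗ W′ → wrapSlice X Y W ≗ wrapSlice X′ Y′ W′
  wrapSlice-cong X≗ Y≗ W≗ n =
    cong₂ (λ a w → a - + 2 * w)
          (cong₂ _+_ (cong₂ _-_ (Δ-cong X≗ n) (shift-cong 2 Y≗ n)) (shift-cong 3 Y≗ n))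
          (shift-cong 3 W≗ n)

  alternatingSum-zero : ∀ f₃ f₂ f₁ f₀ g₁ g₀ t → f₃ ℕ.+ f₀ ℕ.+ g₀ ≡ f₂ ℕ.+ f₁ ℕ.+ g₁ ℕ.+ 2 ℕ.* t
                      → + f₃ - + f₂ - + f₁ + + f₀ - + g₁ + + g₀ - + 2 * + t ≡ + 0
  alternatingSum-zero f₃ f₂ f₁ f₀ g₁ g₀ t eq = begin
    + f₃ - + f₂ - + f₁ + + f₀ - + g₁ + + g₀ - + 2 * + t
      ≡⟨ regroup (+ f₃) (+ f₂) (+ f₁) (+ f₀) (+ g₁) (+ g₀) (+ t) ⟩
    (+ f₃ + + f₀ + + g₀) - (+ f₂ + + f₁ + + g₁ + + 2 * + t)
      ≡⟨ cong₂ _-_ (cong +_ eq) (cong (λ x → + f₂ + + f₁ + + g₁ + x) (sym (pos-* 2 t))) ⟩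
    + (f₂ ℕ.+ f₁ ℕ.+ g₁ ℕ.+ 2 ℕ.* t) - + (f₂ ℕ.+ f₁ ℕ.+ g₁ ℕ.+ 2 ℕ.* t)
      ≡⟨ +-inverseʳ (+ (f₂ ℕ.+ f₁ ℕ.+ g₁ ℕ.+ 2 ℕ.* t)) ⟩
    + 0 ∎
    where
    open ≡-Reasoning
    regroup : ∀ a b c e g h t → a - b - c + e - g + h - + 2 * t ≡ (a + e + h) - (b + c + g + + 2 * t)
    regroup = solve-∀

open Compositions
open PowerSeries

open import Data.Bool using (if_then_else_)
open import Data.Bool.Properties using (∧-zeroʳ)
open import Data.Integer using (+_; _+_; _*_; _-_)
open import Data.Integer.Properties using (*-zeroʳ)
open import Data.Integer.Tactic.RingSolver using (solve-∀)
open import Data.Nat as ℕ using (zero; suc; z≤n; s≤s)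
open import Relation.Binary.PropositionalEquality using (refl; sym; trans; cong; module ≡-Reasoning)

K-noParts : ∀ d n → K d 0 n ≡ δ d 0 * δ n 0
K-noParts zero    zero    = refl
K-noParts (suc d) zero    = refl
K-noParts d       (suc n) =
  trans (K≡statCount d 0 (suc n)) (trans (cong +_ (statCount-noParts d n)) (sym (*-zeroʳ (δ d 0))))

K-onePart : ∀ d n → K d 1 n ≡ δ d 0 * isSuc n
K-onePart d       zero    = sym (*-zeroʳ (δ d 0))
K-onePart d       (suc n) = trans (K≡statCount d 1 (suc n)) (trans (cong +_ (statCount-onePart d n)) (indicator d))
  where
  indicator : ∀ d → + (if 0 ℕ.≡ᵇ d then 1 else 0) ≡ δ d 0 * + 1
  indicator zero    = refl
  indicator (suc d) = refl

tShift-K : ∀ d m n → shift 1 (λ i → shift 3 (K i m) n) d ≡ shift 3 (λ s → + WrappedCounts.T m d s) n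
tShift-K zero    m n = sym (trans (shift-cong 3 (λ s → cong +_ (statCount-false (λ l _ → ∧-zeroʳ (l ℕ.≡ᵇ m)) s)) n)
                                         (shift-zero 3 n))
tShift-K (suc d) m n = shift-cong 3 (K≡statCount d m) n

module _ (m d : ℕ) where
  open WrappedCounts m d

  wrapSlice-vanishes : ∀ n → wrapSlice (λ k → + F k) (λ k → + G k) (λ k → + T k) n ≡ + 0
  wrapSlice-vanishes 0 = refl
  wrapSlice-vanishes 1 = refl
  wrapSlice-vanishes 2 = trans (cong (λ f → + f - + F 1 - + F 0 + + 0 - + G 0 + + 0 - + 2 * + 0) (F-wrap 0)) (cancel (+ G 0))
    where
    cancel : ∀ g → g - + 0 - + 0 + + 0 - g + + 0 - + 2 * + 0 ≡ + 0
    cancel = solve-∀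
  wrapSlice-vanishes (suc (suc (suc n))) =
    alternatingSum-zero (F (3 ℕ.+ n)) (F (2 ℕ.+ n)) (F (1 ℕ.+ n)) (F n) (G (1 ℕ.+ n)) (G n) (T n) (F-recurrence n)

K-wrapSlice : ∀ d m n → denomExpansion K d (suc (suc m)) n
            ≡ wrapSlice (λ k → + WrappedCounts.F m d k) (λ k → + WrappedCounts.G m d k) (λ k → + WrappedCounts.T m d k) n
K-wrapSlice d m n =
  trans (cong (λ w → Δ (K d (suc (suc m))) n - shift 2 (K d m) n + shift 3 (K d m) n - + 2 * w) (tShift-K d m n))
        (wrapSlice-cong (K≡statCount d (suc (suc m))) (K≡statCount d m) (λ _ → refl) n)

coefficients : ∀ d m n → denomExpansion K d m n ≡ numerExpansion d m n
coefficients d 0 n = begin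
  denomExpansion K d 0 n                    ≡⟨ denomExpansion-fewParts K d 0 n (s≤s z≤n) ⟩
  Δ (K d 0) n                               ≡⟨ Δ-cong (K-noParts d) n ⟩
  Δ (λ k → δ d 0 * δ k 0) n                 ≡⟨ Δ-*ˡ (δ d 0) (λ k → δ k 0) n ⟩
  δ d 0 * Δ (λ k → δ k 0) n                 ≡⟨ cong (δ d 0 *_) (Δ-δ₀ n) ⟩
  δ d 0 * (δ n 0 - δ n 1 - δ n 2 + δ n 3)   ≡⟨ expand (δ d 0) (δ n 0) (δ n 1) (δ n 2) (δ n 3) ⟩
  numerExpansion d 0 n                      ∎
  where
  open ≡-Reasoning
  expand : ∀ D a b c e → D * (a - b - c + e)
                       ≡ D * + 1 * a - D * + 1 * b + D * + 0 * b - D * + 1 * c + D * + 1 * e - D * + 0 * e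
  expand = solve-∀
coefficients d 1 n = begin
  denomExpansion K d 1 n                    ≡⟨ denomExpansion-fewParts K d 1 n (s≤s (s≤s z≤n)) ⟩
  Δ (K d 1) n                               ≡⟨ Δ-cong (K-onePart d) n ⟩
  Δ (λ k → δ d 0 * isSuc k) n               ≡⟨ Δ-*ˡ (δ d 0) isSuc n ⟩
  δ d 0 * Δ isSuc n                         ≡⟨ cong (δ d 0 *_) (Δ-isSuc n) ⟩
  δ d 0 * (δ n 1 - δ n 3)                   ≡⟨ expand (δ d 0) (δ n 0) (δ n 1) (δ n 2) (δ n 3) ⟩
  numerExpansion d 1 n                      ∎
  where
  open ≡-Reasoning
  expand : ∀ D a b c e → D * (b - e)
                       ≡ D * + 0 * a - D * + 0 * b + D * + 1 * b - D * + 0 * c + D * + 0 * e - D * + 1 * e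
  expand = solve-∀
coefficients d (suc (suc m)) n =
  trans (K-wrapSlice d m n)
        (trans (wrapSlice-vanishes m d n) (vanish (δ d 0) (δ n 0) (δ n 1) (δ n 2) (δ n 3)))
  where
  vanish : ∀ D a b c e → + 0 ≡ D * + 0 * a - D * + 0 * b + D * + 0 * b - D * + 0 * c + D * + 0 * e - D * + 0 * e
  vanish = solve-∀

proposition2p1 : ∀ (d m n : ℕ) → (K ⊗ denom) d m n ≡ numer d m n
proposition2p1 d m n = begin
  (K ⊗ denom) d m n       ≡⟨ ⊗-denom K d m n ⟩
  denomExpansion K d m n  ≡⟨ coefficients d m n ⟩
  numerExpansion d m n    ≡⟨ numer-expansion d m n ⟨
  numer d m n             ∎
  where open ≡-Reasoning
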